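{- Let $\Phi$ be an annotated \textsc{Lola} specification (as described in the context) with input stream variables $t_1,\dots,t_m$, output stream variables $s_1,\dots,s_n$ with defining stream expressions $e_1,\dots,e_n$, and annotation identifiers $\Gamma$. Let $N\ge 0$ be a natural number. If the formula $$\bigwedge_{i:\,0\le i\le N}\ \Bigl(\ \bigwedge_{\alpha\in\Gamma}\Bigl(\ \bigwedge_{\theta\in \mathit{assume}(\alpha)} \mathit{smt}_N(\theta)(i)\ \wedge\ \bigwedge_{k=1}^{n} \sigma_k^i = \mathit{smt}_N(e_k)(i)\ \rightarrow\ \bigwedge_{\psi\in\mathit{assert}(\alpha)} \mathit{smt}_N(\psi)(i)\Bigr)\Bigr)$$ is valid, then the set of assertions of $\Phi$ is correct for stream executions of length $N+1$.
   Context: An annotated \textsc{Lola} specification $\Phi$ consists of: typed input stream variables $t_1,\dots,t_m$; typed output stream variables $s_1,\dots,s_n$, where each $s_k$ is given a defining stream expression $e_k$ over $t_1,\dots,t_m,s_1,\dots,s_n$; a finite set $\Gamma$ of identifiers; finitely many assumptions $\mathbf{assume}\ \langle\alpha\rangle\ \theta$ and assertions $\mathbf{assert}\ \langle\alpha\rangle\ \psi$, where $\alpha\in\Gamma$ and $\theta,\psi$ are Boolean stream expressions. For $\alpha\in\Gamma$, $\mathit{assume}(\alpha)$ (resp. $\mathit{assert}(\alpha)$) is the set of all $\theta$ (resp. $\psi$) annotated with identifier $\alpha$. Stream expressions are: a constant $c$; a stream variable; $\mathit{ite}(b,e_1,e_2)$ with $b$ Boolean and $e_1,e_2$ of the same type;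 $f(e_1,\dots,e_k)$ for a $k$-ary operator $f$; and an offset access $o[k,d]$ where $o$ is a stream variable of type $T$, $k$ an integer, and $d$ a constant of type $T$ (the default). Stream execution of length $N+1$: values $\tau_i^j$ (for input $t_i$) and $\sigma_k^j$ (for output $s_k$), $0\le j\le N$, of the appropriate types, such that $\sigma_k^j=\mathrm{val}(e_k)(j)$ for all $k,j$, where $\mathrm{val}(c)(j)=c$, $\mathrm{val}(t_i)(j)=\tau_i^j$, $\mathrm{val}(s_k)(j)=\sigma_k^j$, $\mathrm{val}$ commutes with operators and $\mathit{ite}$, and $\mathrm{val}(o[k,d])(j)=\mathrm{val}(o)(j+k)$ if $0\le j+k\le N$ and $=d$ otherwise. The set of assertions is correct for stream executions of length $N+1$ if for every stream execution of length $N+1$ and every $\alpha\in\Gamma$: if every $\theta\in\mathit{assume}(\alpha)$ evaluates to true at every position $0\le j\le N$, then every $\psi\in\mathit{assert}(\alpha)$ evaluates to true at every position $0\le j\le N$. SMT encoding: with SMT variables $\tau_i^j,\sigma_k^j$ ($0\le j\le N$), define $\mathit{smt}_N(c)(j)=c$, $\mathit{smt}_N(t_i)(j)=\tau_i^j$, $\mathit{smt}_N(s_k)(j)=\sigma_k^j$, $\mathit{smt}_N(f(e_1,\dots,e_r))(j)=f(\mathit{smt}_N(e_1)(j),\dots,\mathit{smt}_N(e_r)(j))$, $\mathit{smt}_N(\mathit{ite}(b,e_1,e_2))(j)=\mathit{ite}(\mathit{smt}_N(b)(j),\mathit{smt}_N(e_1)(j),\mathit{smt}_N(e_2)(j))$,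 and $\mathit{smt}_N(o[k,d])(j)=\mathit{smt}_N(o)(j+k)$ if $0\le j+k\le N$, and $d$ otherwise. Operators belonging to a theory supported by the SMT solver are interpreted in that theory; all other operators are uninterpreted function symbols. A formula is valid if it is true for all values of its SMT variables and all interpretations of its uninterpreted function symbols. -}

module Defs where

open import Data.Nat using (ℕ; suc; _<?_)
open import Data.Integer using (ℤ; +_; -[1+_]) renaming (_+_ to _+ℤ_)
open import Data.Fin using (Fin; toℕ; fromℕ<)
open import Data.Bool using (Bool; true; false; if_then_else_)
open import Data.Maybe using (Maybe; just; nothing)
open import Data.List using (List; []; _∷_)
open import Data.List.Relation.Unary.All using (All; []; _∷_)
open import Data.List.Membership.Propositional using (_∈_)
open import Data.Product using (_×_; _,_)
open import Relation.Nullary using (yes; no)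
open import Relation.Binary.PropositionalEquality using (_≡_)

data Ty (S : Set) : Set where
  bool : Ty S
  sort : S → Ty S

ValT : {S : Set} → (S → Set) → Ty S → Set
ValT D bool     = Bool
ValT D (sort s) = D s

-- A signature: sorts with their domains, typed operators, which operators
-- belong to a theory supported by the SMT solver ('interpreted'), and the
-- intended meaning I₀ of every operator (used for stream executions).
record Signature : Set₁ where
  field
    Sort        : Set
    Dom         : Sort → Set
    Op          : List (Ty Sort) → Ty Sort → Set
    interpreted : ∀ {as b} → Op as b → Bool
    I₀          : ∀ {as b} → Op as b → All (ValT Dom) as → ValT Dom b

shift : ∀ {N} → Fin (suc N) → ℤ → Maybe (Fin (suc N))
shift {N} j k with (+ toℕ j) +ℤ k
... | -[1+ _ ] = nothing
... | + p with p <? suc N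
...   | yes lt = just (fromℕ< lt)
...   | no _   = nothing

module Lola (Sg : Signature) where
  open Signature Sg public

  Val : Ty Sort → Set
  Val = ValT Dom

  Interp : Set
  Interp = ∀ {as b} → Op as b → All Val as → Val b

  Agrees : Interp → Set
  Agrees I = ∀ {as b} (f : Op as b) → interpreted f ≡ true →
             ∀ (args : All Val as) → I f args ≡ I₀ f args

  module _ {m n : ℕ} (tin : Fin m → Ty Sort) (tout : Fin n → Ty Sort) where

    data Var : Ty Sort → Set where
      input  : (i : Fin m) → Var (tin i)
      output : (k : Fin n) → Var (tout k)

    data Expr : Ty Sort → Set where
      const  : ∀ {T} → Val T → Expr T
      var    : ∀ {T} → Var T → Expr T
      ite    : ∀ {T} → Expr bool → Expr T → Expr T → Expr T
      app    : ∀ {as b} → Op as b → All Expr as → Expr b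
      offset : ∀ {T} → Var T → ℤ → Val T → Expr T

  -- annotated Lola specification; Γ = Fin g
  record Spec : Set where
    field
      m n         : ℕ
      tin         : Fin m → Ty Sort
      tout        : Fin n → Ty Sort
      defn        : (k : Fin n) → Expr tin tout (tout k)
      g           : ℕ
      assumptions : List (Fin g × Expr tin tout bool)
      assertions  : List (Fin g × Expr tin tout bool)

  module Semantics (Φ : Spec) (N : ℕ) where
    open Spec Φ

    V : Ty Sort → Set
    V = Var tin tout

    E : Ty Sort → Set
    E = Expr tin tout

    Pos : Set
    Pos = Fin (suc N)

    Valuation : Set
    Valuation = ∀ {T} → V T → Pos → Val T

    mutual
      val : ∀ {T} → Interp → Valuation → E T → Pos → Val T
      val I ρ (const c) j = c
      val I ρ (var o) j = ρ o j
      val I ρ (ite b e₁ e₂) j =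
        if val I ρ b j then val I ρ e₁ j else val I ρ e₂ j
      val I ρ (app f es) j = I f (vals I ρ es j)
      val I ρ (offset o k d) j with shift j k
      ... | just j′ = ρ o j′
      ... | nothing = d

      vals : ∀ {as} → Interp → Valuation → All E as → Pos → All Val as
      vals I ρ [] j = []
      vals I ρ (e ∷ es) j = val I ρ e j ∷ vals I ρ es j

    combine : ((i : Fin m) → Pos → Val (tin i)) →
              ((k : Fin n) → Pos → Val (tout k)) → Valuation
    combine τ σ (input i)  = τ i
    combine τ σ (output k) = σ k

    record Execution : Set where
      field
        τ : (i : Fin m) → Pos → Val (tin i)
        σ : (k : Fin n) → Pos → Val (tout k)
        consistent : ∀ k j → σ k j ≡ val I₀ (combine τ σ) (defn k) j
      ρ : Valuation
      ρ = combine τ σ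

    Correct : Set
    Correct = (ex : Execution) → ∀ (α : Fin g) →
      (∀ θ → (α , θ) ∈ assumptions → ∀ j → val I₀ (Execution.ρ ex) θ j ≡ true) →
      (∀ ψ → (α , ψ) ∈ assertions → ∀ j → val I₀ (Execution.ρ ex) ψ j ≡ true)

    ---------------- SMT terms and the encoding smt_N ----------------
    -- SMT variables: τ_i^j = svar (input i) j, σ_k^j = svar (output k) j
    data Term : Ty Sort → Set where
      tconst : ∀ {T} → Val T → Term T
      svar   : ∀ {T} → V T → Pos → Term T
      tite   : ∀ {T} → Term bool → Term T → Term T → Term T
      tapp   : ∀ {as b} → Op as b → All Term as → Term b

    mutual
      smt : ∀ {T} → E T → Pos → Term T
      smt (const c) j = tconst c
      smt (var o) j = svar o j
      smt (ite b e₁ e₂) j = tite (smt b j) (smt e₁ j) (smt e₂ j)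
      smt (app f es) j = tapp f (smts es j)
      smt (offset o k d) j with shift j k
      ... | just j′ = svar o j′
      ... | nothing = tconst d

      smts : ∀ {as} → All E as → Pos → All Term as
      smts [] j = []
      smts (e ∷ es) j = smt e j ∷ smts es j

    Assignment : Set
    Assignment = Valuation

    mutual
      ⟦_⟧ : ∀ {T} → Term T → Interp → Assignment → Val T
      ⟦ tconst c ⟧ I a = c
      ⟦ svar o j ⟧ I a = a o j
      ⟦ tite b t₁ t₂ ⟧ I a = if ⟦ b ⟧ I a then ⟦ t₁ ⟧ I a else ⟦ t₂ ⟧ I a
      ⟦ tapp f ts ⟧ I a = I f (⟦ ts ⟧* I a)

      ⟦_⟧* : ∀ {as} → All Term as → Interp → Assignment → All Val as
      ⟦ [] ⟧* I a = []
      ⟦ t ∷ ts ⟧* I a = ⟦ t ⟧ I a ∷ ⟦ ts ⟧* I a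

    Formula : Interp → Assignment → Set
    Formula I a = ∀ (i : Pos) (α : Fin g) →
      (∀ θ → (α , θ) ∈ assumptions → ⟦ smt θ i ⟧ I a ≡ true) →
      (∀ k → a (output k) i ≡ ⟦ smt (defn k) i ⟧ I a) →
      (∀ ψ → (α , ψ) ∈ assertions → ⟦ smt ψ i ⟧ I a ≡ true)

    Valid : Set
    Valid = ∀ (I : Interp) → Agrees I → ∀ (a : Assignment) → Formula I a

-- The encoding smt_N mirrors the stream semantics clause by clause, so under
-- any interpretation I and valuation ρ the term smt_N(e)(j) evaluates to
-- val(e)(j). A stream execution, read as an assignment under the intended
-- interpretation I₀, thus meets every premise of the valid formula at every
-- position, and the formula's conclusion yields the assertions.
module Submission where

open import Data.Nat using (ℕ)
open import Data.Bool using (true)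
open import Data.Maybe using (just; nothing)
open import Data.Product using (_,_)
open import Data.List.Relation.Unary.All using (All; []; _∷_)
open import Data.List.Membership.Propositional using (_∈_)
open import Relation.Binary.PropositionalEquality using (_≡_; refl; sym; trans; cong; cong₂)
open import Defs

module SmtSoundness (Sg : Signature) (Φ : Lola.Spec Sg) (N : ℕ) where
  open Lola Sg
  open Semantics Φ N

  I₀-agrees : Agrees I₀
  I₀-agrees f _ args = refl

  mutual
    val≡⟦smt⟧ : ∀ {T} (I : Interp) (ρ : Valuation) (e : E T) (j : Pos) →
                val I ρ e j ≡ ⟦ smt e j ⟧ I ρ
    val≡⟦smt⟧ I ρ (const c) j = refl
    val≡⟦smt⟧ I ρ (var o) j = refl
    val≡⟦smt⟧ I ρ (ite b e₁ e₂) j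
      rewrite val≡⟦smt⟧ I ρ b j | val≡⟦smt⟧ I ρ e₁ j | val≡⟦smt⟧ I ρ e₂ j = refl
    val≡⟦smt⟧ I ρ (app f es) j = cong (I f) (vals≡⟦smts⟧ I ρ es j)
    val≡⟦smt⟧ I ρ (offset o k d) j with shift j k
    ... | just j′ = refl
    ... | nothing = refl

    vals≡⟦smts⟧ : ∀ {as} (I : Interp) (ρ : Valuation) (es : All E as) (j : Pos) →
                  vals I ρ es j ≡ ⟦ smts es j ⟧* I ρ
    vals≡⟦smts⟧ I ρ [] j = refl
    vals≡⟦smts⟧ I ρ (e ∷ es) j = cong₂ _∷_ (val≡⟦smt⟧ I ρ e j) (vals≡⟦smts⟧ I ρ es j)

  valid⇒correct : Valid → Correct
  valid⇒correct valid ex α assumed ψ ψ∈ j =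
    trans (val≡⟦smt⟧ I₀ ρ ψ j)
      (valid I₀ I₀-agrees ρ j α assumed-smt defining-equations ψ ψ∈)
    where
      open Execution ex

      assumed-smt : ∀ θ → (α , θ) ∈ Spec.assumptions Φ → ⟦ smt θ j ⟧ I₀ ρ ≡ true
      assumed-smt θ θ∈ = trans (sym (val≡⟦smt⟧ I₀ ρ θ j)) (assumed θ θ∈ j)

      defining-equations : ∀ k → ρ (output k) j ≡ ⟦ smt (Spec.defn Φ k) j ⟧ I₀ ρ
      defining-equations k = trans (consistent k j) (val≡⟦smt⟧ I₀ ρ (Spec.defn Φ k) j)

proposition1 : (Sg : Signature) (Φ : Lola.Spec Sg) (N : ℕ) →
    Lola.Semantics.Valid Sg Φ N → Lola.Semantics.Correct Sg Φ N
proposition1 Sg Φ N = SmtSoundness.valid⇒correct Sg Φ N
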